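{- Let $m,r,s$ be integers with $m\geq r\geq 0$ and $s\geq 0$. Then for $|x|<1$, $$\sum_{n=r}^{\infty}\Bigl(\sum_{k=0}^{n}\binom{k}{r}\binom{n+s-k}{s}r!\,k^{m-r}H_k\Bigr)x^{n}=\sum_{n=r}^{\infty}\Bigl(\sum_{0\leq k_1\leq k_2\leq\cdots\leq k_{s+1}\leq n}\binom{k_1}{r}r!\,k_1^{m-r}H_{k_1}\Bigr)x^{n}=\frac{1}{(1-x)^{s+2}}\Bigl\{{}_rF^{h}_{m}\Bigl(\frac{x}{1-x}\Bigr)-{}_rF_{m}\Bigl(\frac{x}{1-x}\Bigr)\ln(1-x)\Bigr\}.$$
   Context: $H_k=\sum_{j=1}^{k}\frac1j$, $H_0=0$, and $0^0=1$. The $r$-Stirling numbers of the second kind $\left\{ {n \atop k}\right\}_r$ count partitions of $\{1,\dots,n\}$ into $k$ nonempty blocks with $1,\dots,r$ in distinct blocks. The $r$-geometric polynomials are ${}_rF_n(y)=\sum_{k=0}^{n}\left\{ {n \atop k}\right\}_r k!\,y^k$ and the harmonic $r$-geometric polynomials are ${}_rF^h_n(y)=\sum_{k=0}^{n}\left\{ {n \atop k}\right\}_r k!\,H_k\,y^k$. -}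

module Defs where

open import Data.Nat as ℕ using (ℕ; zero; suc; _∸_; _^_; _≟_; _<?_; _!)
open import Data.Nat.Combinatorics using (_C_)
open import Data.Integer using (+_)
open import Data.Rational using (ℚ; 0ℚ; 1ℚ; _+_; _*_; _-_; -_; _/_)
open import Data.Bool using (if_then_else_)
open import Relation.Nullary.Decidable using (⌊_⌋)

ι : ℕ → ℚ
ι n = + n / 1

Σ≤ : ℕ → (ℕ → ℚ) → ℚ
Σ≤ zero    f = f 0
Σ≤ (suc n) f = Σ≤ n f + f (suc n)

H : ℕ → ℚ
H zero    = 0ℚ
H (suc k) = H k + (+ 1 / suc k)

-- r-Stirling numbers of the second kind  {n k}_r  (Broder's recurrence):
--   {n k}_r = 0 for n < r;  {r k}_r = δ_{k,r};
--   {n k}_r = k {n-1 k}_r + {n-1 k-1}_r  for n > r  (and {n 0}_r = 0 for n > r).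
rS : ℕ → ℕ → ℕ → ℕ
rS r zero    zero    = if ⌊ r ≟ 0 ⌋ then 1 else 0
rS r zero    (suc k) = 0
rS r (suc n) zero    = 0
rS r (suc n) (suc k) =
  if ⌊ suc n <? r ⌋ then 0
  else if ⌊ suc n ≟ r ⌋ then (if ⌊ suc k ≟ r ⌋ then 1 else 0)
  else suc k ℕ.* rS r n (suc k) ℕ.+ rS r n k

-- formal power series over ℚ, as coefficient sequences
Series : Set
Series = ℕ → ℚ

_⊕_ : Series → Series → Series
(a ⊕ b) n = a n + b n

_⊖_ : Series → Series → Series
(a ⊖ b) n = a n - b n

_⊛_ : Series → Series → Series
(a ⊛ b) n = Σ≤ n (λ k → a k * b (n ∸ k))

one : Series
one zero    = 1ℚ
one (suc n) = 0ℚ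

_^ˢ_ : Series → ℕ → Series
a ^ˢ zero  = one
a ^ˢ suc k = a ⊛ (a ^ˢ k)

scale : ℚ → Series → Series
scale c a n = c * a n

-- 1/(1-x) = Σ x^n
geom : Series
geom n = 1ℚ

xOver1mx : Series
xOver1mx zero    = 0ℚ
xOver1mx (suc n) = 1ℚ

ln1mx : Series
ln1mx zero    = 0ℚ
ln1mx (suc j) = - (+ 1 / suc j)

evalPoly : ℕ → (ℕ → ℚ) → Series → Series
evalPoly m c y n = Σ≤ m (λ k → c k * (y ^ˢ k) n)

-- r-geometric polynomial coefficients  {m k}_r k!   and harmonic version
rFcoef : ℕ → ℕ → ℕ → ℚ
rFcoef r m k = ι (rS r m k ℕ.* (k !))

rFhcoef : ℕ → ℕ → ℕ → ℚ
rFhcoef r m k = ι (rS r m k ℕ.* (k !)) * H k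

-- summand  C(k,r) r! k^{m-r} H_k   (0^0 = 1 via ℕ._^_)
term : ℕ → ℕ → ℕ → ℚ
term m r k = ι ((k C r) ℕ.* (r !) ℕ.* (k ^ (m ∸ r))) * H k

-- sum over 0 ≤ k_1 ≤ k_2 ≤ ... ≤ k_t ≤ n of f(k_1), t ≥ 1 (t = suc u)
chainSum : ℕ → (ℕ → ℚ) → ℕ → ℚ
chainSum zero    f n = Σ≤ n f
chainSum (suc u) f n = Σ≤ n (λ k → chainSum u f k)

fromIdx : ℕ → (ℕ → ℚ) → Series
fromIdx r a n = if ⌊ n <? r ⌋ then 0ℚ else a n

lhsSeries : ℕ → ℕ → ℕ → Series
lhsSeries m r s = fromIdx r (λ n →
  Σ≤ n (λ k → ι ((n ℕ.+ s ∸ k) C s) * term m r k))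

midSeries : ℕ → ℕ → ℕ → Series
midSeries m r s = fromIdx r (chainSum s (term m r))

rhsSeries : ℕ → ℕ → ℕ → Series
rhsSeries m r s =
  (geom ^ˢ (s ℕ.+ 2)) ⊛
    (evalPoly m (rFhcoef r m) xOver1mx ⊖ (evalPoly m (rFcoef r m) xOver1mx ⊛ ln1mx))

module Submission where

-- Write y = x/(1-x), ∂ for partial summation (the
-- coefficients of a/(1-x)) and let  bracket = rF^h_m(y) - rF_m(y)·ln(1-x)
-- be the series in braces.  Three coefficient identities carry the argument:
--   (a) [x^n] y^k/(1-x)                  = C(n,k)                    (partial-powerY)
--   (b) [x^n] y^k/(1-x)·(H_k - ln(1-x))  = C(n,k)·H_n                (partial-harmonicY)
--   (c) Σ_k {m k}_r k!·C(n,k)            = C(n,r)·r!·n^(m-r), r ≤ m  (rGeomBinom-closed)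
-- Summing (b) against the coefficients {m k}_r k! and applying (c) shows
-- that ∂ bracket is the summand  C(n,r) r! n^(m-r) H_n  (partial-bracket).
-- Multiplication by 1/(1-x)^(s+1) is (s+1)-fold partial summation, which is
-- the chain sum over k₁ ≤ … ≤ k_(s+1) ≤ n; that chain sum in turn equals the
-- binomially weighted sum Σ_k C(n+s-k,s) f(k) by Pascal's rule.

open import Defs
open import Data.Nat using (ℕ; _≤_)
open import Data.Product using (_×_)
open import Relation.Binary.PropositionalEquality using (_≡_)

open import Data.Nat as ℕ using (zero; suc; _∸_; _<_; z≤n; s≤s; _<?_; _≟_; _!)
import Data.Nat.Properties as ℕP
open import Data.Nat.Combinatorics using (_C_; nCk+nC[k+1]≡[n+1]C[k+1]; nC1≡n; nCn≡1; k>n⇒nCk≡0)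
open import Data.Nat.Coprimality using (1-coprimeTo) renaming (sym to coprime-sym)
open import Data.Nat.Tactic.RingSolver using (solve-∀)
open import Data.Integer as ℤ using (+_)
import Data.Integer.Properties as ℤP
open import Data.Rational using (ℚ; mkℚ; 0ℚ; 1ℚ; _+_; _*_; _-_; -_; _/_)
import Data.Rational.Properties as ℚP
open import Data.Rational.Solver using (module +-*-Solver)
open +-*-Solver using (solve; _:+_; _:-_; _:*_; :-_; con; _:=_)
open import Data.Bool using (if_then_else_)
open import Data.Empty using (⊥-elim)
open import Data.Product using (_,_)
open import Relation.Nullary using (Dec; yes; no; ¬_)
open import Relation.Nullary.Decidable using (⌊_⌋)
open import Relation.Binary.PropositionalEquality using (refl; sym; trans; cong; cong₂; subst; module ≡-Reasoning)
open ≡-Reasoning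

-- ι n is already in normal form, so arithmetic on it reduces to numerators.
ι-mkℚ : ∀ n → ι n ≡ mkℚ (+ n) 0 (coprime-sym (1-coprimeTo n))
ι-mkℚ n = ℚP.normalize-coprime (coprime-sym (1-coprimeTo n))

ι-+ : ∀ a b → ι (a ℕ.+ b) ≡ ι a + ι b
ι-+ a b = trans (cong (_/ 1) (sym (cong₂ ℤ._+_ (ℤP.*-identityʳ (+ a)) (ℤP.*-identityʳ (+ b)))))
                (sym (cong₂ _+_ (ι-mkℚ a) (ι-mkℚ b)))

ι-* : ∀ a b → ι (a ℕ.* b) ≡ ι a * ι b
ι-* a b = trans (cong (_/ 1) (ℤP.pos-* a b)) (sym (cong₂ _*_ (ι-mkℚ a) (ι-mkℚ b)))

ι-*-inverse : ∀ a → ι (suc a) * (+ 1 / suc a) ≡ 1ℚ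
ι-*-inverse a = trans (cong₂ _*_ (ι-mkℚ (suc a)) (ℚP.normalize-coprime (1-coprimeTo (suc a))))
                      (ℚP.*-inverseʳ (mkℚ (+ suc a) 0 (coprime-sym (1-coprimeTo (suc a)))))

Σ-cong-≤ : ∀ n {f g : ℕ → ℚ} → (∀ k → k ≤ n → f k ≡ g k) → Σ≤ n f ≡ Σ≤ n g
Σ-cong-≤ zero    eq = eq 0 z≤n
Σ-cong-≤ (suc n) eq = cong₂ _+_ (Σ-cong-≤ n (λ k k≤n → eq k (ℕP.m≤n⇒m≤1+n k≤n))) (eq (suc n) ℕP.≤-refl)

Σ-cong : ∀ n {f g : ℕ → ℚ} → (∀ k → f k ≡ g k) → Σ≤ n f ≡ Σ≤ n g
Σ-cong n eq = Σ-cong-≤ n (λ k _ → eq k)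

Σ-zero : ∀ n (f : ℕ → ℚ) → (∀ k → k ≤ n → f k ≡ 0ℚ) → Σ≤ n f ≡ 0ℚ
Σ-zero zero    f h = h 0 z≤n
Σ-zero (suc n) f h = cong₂ _+_ (Σ-zero n f (λ k k≤n → h k (ℕP.m≤n⇒m≤1+n k≤n))) (h (suc n) ℕP.≤-refl)

Σ-+ : ∀ n (f g : ℕ → ℚ) → Σ≤ n (λ k → f k + g k) ≡ Σ≤ n f + Σ≤ n g
Σ-+ zero    f g = refl
Σ-+ (suc n) f g = begin
  Σ≤ n (λ k → f k + g k) + (f (suc n) + g (suc n))
    ≡⟨ cong (_+ (f (suc n) + g (suc n))) (Σ-+ n f g) ⟩
  (Σ≤ n f + Σ≤ n g) + (f (suc n) + g (suc n))
    ≡⟨ solve 4 (λ a b c d → (a :+ b) :+ (c :+ d) := (a :+ c) :+ (b :+ d)) refl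
             (Σ≤ n f) (Σ≤ n g) (f (suc n)) (g (suc n)) ⟩
  (Σ≤ n f + f (suc n)) + (Σ≤ n g + g (suc n)) ∎

Σ-*ˡ : ∀ n (c : ℚ) (f : ℕ → ℚ) → Σ≤ n (λ k → c * f k) ≡ c * Σ≤ n f
Σ-*ˡ zero    c f = refl
Σ-*ˡ (suc n) c f = begin
  Σ≤ n (λ k → c * f k) + c * f (suc n) ≡⟨ cong (_+ c * f (suc n)) (Σ-*ˡ n c f) ⟩
  c * Σ≤ n f + c * f (suc n)           ≡⟨ sym (ℚP.*-distribˡ-+ c (Σ≤ n f) (f (suc n))) ⟩
  c * (Σ≤ n f + f (suc n))             ∎

Σ-*ʳ : ∀ n (c : ℚ) (f : ℕ → ℚ) → Σ≤ n (λ k → f k * c) ≡ Σ≤ n f * c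
Σ-*ʳ n c f = trans (Σ-cong n (λ k → ℚP.*-comm (f k) c)) (trans (Σ-*ˡ n c f) (ℚP.*-comm c (Σ≤ n f)))

Σ-- : ∀ n (f g : ℕ → ℚ) → Σ≤ n (λ k → f k - g k) ≡ Σ≤ n f - Σ≤ n g
Σ-- zero    f g = refl
Σ-- (suc n) f g = begin
  Σ≤ n (λ k → f k - g k) + (f (suc n) - g (suc n))
    ≡⟨ cong (_+ (f (suc n) - g (suc n))) (Σ-- n f g) ⟩
  (Σ≤ n f - Σ≤ n g) + (f (suc n) - g (suc n))
    ≡⟨ solve 4 (λ a b c d → (a :- b) :+ (c :- d) := (a :+ c) :- (b :+ d)) refl
             (Σ≤ n f) (Σ≤ n g) (f (suc n)) (g (suc n)) ⟩
  (Σ≤ n f + f (suc n)) - (Σ≤ n g + g (suc n)) ∎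

Σ-swap : ∀ n m (f : ℕ → ℕ → ℚ) → Σ≤ n (λ i → Σ≤ m (f i)) ≡ Σ≤ m (λ k → Σ≤ n (λ i → f i k))
Σ-swap zero    m f = refl
Σ-swap (suc n) m f = begin
  Σ≤ n (λ i → Σ≤ m (f i)) + Σ≤ m (f (suc n))
    ≡⟨ cong (_+ Σ≤ m (f (suc n))) (Σ-swap n m f) ⟩
  Σ≤ m (λ k → Σ≤ n (λ i → f i k)) + Σ≤ m (f (suc n))
    ≡⟨ sym (Σ-+ m (λ k → Σ≤ n (λ i → f i k)) (f (suc n))) ⟩
  Σ≤ m (λ k → Σ≤ (suc n) (λ i → f i k)) ∎

Σ-front : ∀ n (f : ℕ → ℚ) → Σ≤ (suc n) f ≡ f 0 + Σ≤ n (λ k → f (suc k))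
Σ-front zero    f = refl
Σ-front (suc n) f = begin
  Σ≤ (suc n) f + f (suc (suc n))                     ≡⟨ cong (_+ f (suc (suc n))) (Σ-front n f) ⟩
  (f 0 + Σ≤ n (λ k → f (suc k))) + f (suc (suc n))   ≡⟨ ℚP.+-assoc (f 0) _ _ ⟩
  f 0 + (Σ≤ n (λ k → f (suc k)) + f (suc (suc n)))   ∎

Σ-shift : ∀ n (f : ℕ → ℚ) → f 0 ≡ 0ℚ → f (suc n) ≡ 0ℚ → Σ≤ n (λ k → f (suc k)) ≡ Σ≤ n f
Σ-shift n f first-zero last-zero = begin
  Σ≤ n (λ k → f (suc k))        ≡⟨ sym (ℚP.+-identityˡ _) ⟩
  0ℚ + Σ≤ n (λ k → f (suc k))   ≡⟨ cong (_+ Σ≤ n (λ k → f (suc k))) (sym first-zero) ⟩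
  f 0 + Σ≤ n (λ k → f (suc k))  ≡⟨ sym (Σ-front n f) ⟩
  Σ≤ n f + f (suc n)            ≡⟨ cong (λ z → Σ≤ n f + z) last-zero ⟩
  Σ≤ n f + 0ℚ                   ≡⟨ ℚP.+-identityʳ _ ⟩
  Σ≤ n f                        ∎

Σ-reverse : ∀ n (f : ℕ → ℚ) → Σ≤ n f ≡ Σ≤ n (λ k → f (n ∸ k))
Σ-reverse zero    f = refl
Σ-reverse (suc n) f = begin
  Σ≤ n f + f (suc n)                    ≡⟨ ℚP.+-comm (Σ≤ n f) (f (suc n)) ⟩
  f (suc n) + Σ≤ n f                    ≡⟨ cong (λ z → f (suc n) + z) (Σ-reverse n f) ⟩
  f (suc n) + Σ≤ n (λ k → f (n ∸ k))    ≡⟨ sym (Σ-front n (λ k → f (suc n ∸ k))) ⟩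
  Σ≤ (suc n) (λ k → f (suc n ∸ k))      ∎

-- Cauchy product and partial sums.  ∂ a has the coefficients of a/(1-x),
-- and ∂^ j a those of a/(1-x)^j.

∂ : Series → Series
∂ a n = Σ≤ n a

∂^ : ℕ → Series → Series
∂^ zero    a = a
∂^ (suc j) a = ∂ (∂^ j a)

∂^-cong : ∀ j (a b : Series) → (∀ k → a k ≡ b k) → ∀ n → ∂^ j a n ≡ ∂^ j b n
∂^-cong zero    a b eq n = eq n
∂^-cong (suc j) a b eq n = Σ-cong n (∂^-cong j a b eq)

∂^-∂ : ∀ j (a : Series) n → ∂^ j (∂ a) n ≡ ∂^ (suc j) a n
∂^-∂ zero    a n = refl
∂^-∂ (suc j) a n = Σ-cong n (∂^-∂ j a)

∂^-vanish : ∀ j (a : Series) n → (∀ k → k ≤ n → a k ≡ 0ℚ) → ∂^ j a n ≡ 0ℚ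
∂^-vanish zero    a n h = h n ℕP.≤-refl
∂^-vanish (suc j) a n h =
  Σ-zero n (∂^ j a) (λ k k≤n → ∂^-vanish j a k (λ i i≤k → h i (ℕP.≤-trans i≤k k≤n)))

suc-∸ : ∀ n k → k ≤ n → suc n ∸ k ≡ suc (n ∸ k)
suc-∸ n k k≤n = ℕP.+-∸-assoc 1 k≤n

⊛-comm : ∀ (a b : Series) n → (a ⊛ b) n ≡ (b ⊛ a) n
⊛-comm a b n = begin
  Σ≤ n (λ k → a k * b (n ∸ k))               ≡⟨ Σ-reverse n (λ k → a k * b (n ∸ k)) ⟩
  Σ≤ n (λ k → a (n ∸ k) * b (n ∸ (n ∸ k)))   ≡⟨ Σ-cong-≤ n flip ⟩
  Σ≤ n (λ k → b k * a (n ∸ k))               ∎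
  where
  flip : ∀ k → k ≤ n → a (n ∸ k) * b (n ∸ (n ∸ k)) ≡ b k * a (n ∸ k)
  flip k k≤n = trans (cong (λ i → a (n ∸ k) * b i) (ℕP.m∸[m∸n]≡n k≤n)) (ℚP.*-comm (a (n ∸ k)) (b k))

⊛-congˡ : ∀ (a a′ b : Series) n → (∀ k → a k ≡ a′ k) → (a ⊛ b) n ≡ (a′ ⊛ b) n
⊛-congˡ a a′ b n eq = Σ-cong n (λ k → cong (_* b (n ∸ k)) (eq k))

one-⊛ : ∀ (b : Series) n → (one ⊛ b) n ≡ b n
one-⊛ b zero    = ℚP.*-identityˡ (b 0)
one-⊛ b (suc n) = begin
  (one ⊛ b) (suc n)                                ≡⟨ Σ-front n (λ k → one k * b (suc n ∸ k)) ⟩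
  1ℚ * b (suc n) + Σ≤ n (λ k → 0ℚ * b (n ∸ k))
    ≡⟨ cong₂ _+_ (ℚP.*-identityˡ (b (suc n))) (Σ-zero n _ (λ k _ → ℚP.*-zeroˡ (b (n ∸ k)))) ⟩
  b (suc n) + 0ℚ                                   ≡⟨ ℚP.+-identityʳ (b (suc n)) ⟩
  b (suc n)                                        ∎

⊛-geom : ∀ (a : Series) n → (a ⊛ geom) n ≡ ∂ a n
⊛-geom a n = Σ-cong n (λ k → ℚP.*-identityʳ (a k))

⊛-∂ : ∀ (a b : Series) n → (a ⊛ ∂ b) n ≡ ∂ (a ⊛ b) n
⊛-∂ a b zero    = refl
⊛-∂ a b (suc n) = begin
  Σ≤ n (λ k → a k * ∂ b (suc n ∸ k)) + a (suc n) * ∂ b (n ∸ n)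
    ≡⟨ cong₂ _+_ (Σ-cong-≤ n (λ k k≤n → cong (λ i → a k * ∂ b i) (suc-∸ n k k≤n)))
                 (cong (λ i → a (suc n) * ∂ b i) (ℕP.n∸n≡0 n)) ⟩
  Σ≤ n (λ k → a k * (∂ b (n ∸ k) + b (suc (n ∸ k)))) + a (suc n) * b 0
    ≡⟨ cong (_+ a (suc n) * b 0) (trans (Σ-cong n (λ k → ℚP.*-distribˡ-+ (a k) _ _)) (Σ-+ n _ _)) ⟩
  ((a ⊛ ∂ b) n + Σ≤ n (λ k → a k * b (suc (n ∸ k)))) + a (suc n) * b 0
    ≡⟨ ℚP.+-assoc ((a ⊛ ∂ b) n) _ _ ⟩
  (a ⊛ ∂ b) n + (Σ≤ n (λ k → a k * b (suc (n ∸ k))) + a (suc n) * b 0)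
    ≡⟨ cong₂ _+_ (⊛-∂ a b n)
                 (cong₂ _+_ (Σ-cong-≤ n (λ k k≤n → cong (λ i → a k * b i) (sym (suc-∸ n k k≤n))))
                            (cong (λ i → a (suc n) * b i) (sym (ℕP.n∸n≡0 n)))) ⟩
  ∂ (a ⊛ b) n + (a ⊛ b) (suc n) ∎

geom^-⊛ : ∀ j (a : Series) n → ((geom ^ˢ j) ⊛ a) n ≡ ∂^ j a n
geom^-⊛ zero    a n = one-⊛ a n
geom^-⊛ (suc j) a n = begin
  ((geom ⊛ (geom ^ˢ j)) ⊛ a) n
    ≡⟨ ⊛-congˡ _ (∂ (geom ^ˢ j)) a n (λ k → trans (⊛-comm geom (geom ^ˢ j) k) (⊛-geom (geom ^ˢ j) k)) ⟩
  (∂ (geom ^ˢ j) ⊛ a) n   ≡⟨ ⊛-comm (∂ (geom ^ˢ j)) a n ⟩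
  (a ⊛ ∂ (geom ^ˢ j)) n   ≡⟨ ⊛-∂ a (geom ^ˢ j) n ⟩
  ∂ (a ⊛ (geom ^ˢ j)) n   ≡⟨ Σ-cong n (λ k → trans (⊛-comm a (geom ^ˢ j) k) (geom^-⊛ j a k)) ⟩
  ∂^ (suc j) a n          ∎

evalPoly-⊛ : ∀ m (c : ℕ → ℚ) (y b : Series) n →
             (evalPoly m c y ⊛ b) n ≡ Σ≤ m (λ k → c k * ((y ^ˢ k) ⊛ b) n)
evalPoly-⊛ m c y b n = begin
  Σ≤ n (λ i → Σ≤ m (λ k → c k * (y ^ˢ k) i) * b (n ∸ i))
    ≡⟨ Σ-cong n (λ i → trans (sym (Σ-*ʳ m (b (n ∸ i)) (λ k → c k * (y ^ˢ k) i)))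
                             (Σ-cong m (λ k → ℚP.*-assoc (c k) ((y ^ˢ k) i) (b (n ∸ i))))) ⟩
  Σ≤ n (λ i → Σ≤ m (λ k → c k * ((y ^ˢ k) i * b (n ∸ i))))
    ≡⟨ Σ-swap n m (λ i k → c k * ((y ^ˢ k) i * b (n ∸ i))) ⟩
  Σ≤ m (λ k → Σ≤ n (λ i → c k * ((y ^ˢ k) i * b (n ∸ i))))
    ≡⟨ Σ-cong m (λ k → Σ-*ˡ n (c k) (λ i → (y ^ˢ k) i * b (n ∸ i))) ⟩
  Σ≤ m (λ k → c k * ((y ^ˢ k) ⊛ b) n) ∎

-- Binomial coefficients.  The binomial series  binom k n = C(n,k)  has
-- generating function x^k/(1-x)^(k+1) = y^k/(1-x).

binom : ℕ → Series
binom k n = ι (n C k)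

nC0≡1 : ∀ n → n C 0 ≡ 1
nC0≡1 zero    = refl
nC0≡1 (suc n) = refl

pascal : ∀ n k → suc n C suc k ≡ n C k ℕ.+ n C suc k
pascal n k = sym (nCk+nC[k+1]≡[n+1]C[k+1] n k)

binom-zero : ∀ n → binom 0 n ≡ 1ℚ
binom-zero n = cong ι (nC0≡1 n)

binom-pascal : ∀ k n → binom (suc k) (suc n) ≡ binom k n + binom (suc k) n
binom-pascal k n = trans (cong ι (pascal n k)) (ι-+ (n C k) (n C suc k))

absorption : ∀ n k → suc k ℕ.* (suc n C suc k) ≡ suc n ℕ.* (n C k)
absorption zero    zero    = refl
absorption zero    (suc k) = ℕP.*-zeroʳ (suc (suc k))
absorption (suc n) zero    = begin
  1 ℕ.* (suc (suc n) C 1)    ≡⟨ ℕP.*-identityˡ _ ⟩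
  suc (suc n) C 1            ≡⟨ nC1≡n (suc (suc n)) ⟩
  suc (suc n)                ≡⟨ sym (ℕP.*-identityʳ (suc (suc n))) ⟩
  suc (suc n) ℕ.* 1          ≡⟨ cong (suc (suc n) ℕ.*_) (sym (nC0≡1 (suc n))) ⟩
  suc (suc n) ℕ.* (suc n C 0) ∎
absorption (suc n) (suc k) = begin
  suc (suc k) ℕ.* (suc (suc n) C suc (suc k))   ≡⟨ cong (suc (suc k) ℕ.*_) (pascal (suc n) (suc k)) ⟩
  suc (suc k) ℕ.* (A ℕ.+ B)                      ≡⟨ split k A B ⟩
  suc k ℕ.* A ℕ.+ A ℕ.+ suc (suc k) ℕ.* B
    ≡⟨ cong₂ (λ u v → u ℕ.+ A ℕ.+ v) (absorption n k) (absorption n (suc k)) ⟩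
  suc n ℕ.* c ℕ.+ A ℕ.+ suc n ℕ.* d              ≡⟨ join n c d A ⟩
  suc n ℕ.* (c ℕ.+ d) ℕ.+ A                      ≡⟨ cong (λ z → suc n ℕ.* z ℕ.+ A) (sym (pascal n k)) ⟩
  suc n ℕ.* A ℕ.+ A                              ≡⟨ ℕP.+-comm (suc n ℕ.* A) A ⟩
  suc (suc n) ℕ.* A                              ∎
  where
  A = suc n C suc k
  B = suc n C suc (suc k)
  c = n C k
  d = n C suc k
  split : ∀ k A B → suc (suc k) ℕ.* (A ℕ.+ B) ≡ suc k ℕ.* A ℕ.+ A ℕ.+ suc (suc k) ℕ.* B
  split = solve-∀
  join : ∀ n c d A → suc n ℕ.* c ℕ.+ A ℕ.+ suc n ℕ.* d ≡ suc n ℕ.* (c ℕ.+ d) ℕ.+ A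
  join = solve-∀

-- The weighted Pascal rule  k·C(n,k) + (k+1)·C(n,k+1) = n·C(n,k),
-- i.e. the derivative of (1+t)^n recovered from its coefficients.
binomial-weight : ∀ n k → k ℕ.* (n C k) ℕ.+ suc k ℕ.* (n C suc k) ≡ n ℕ.* (n C k)
binomial-weight zero    zero    = refl
binomial-weight zero    (suc k) = cong₂ ℕ._+_ (ℕP.*-zeroʳ (suc k)) (ℕP.*-zeroʳ (suc (suc k)))
binomial-weight (suc n) zero    = absorption n zero
binomial-weight (suc n) (suc k) = begin
  suc k ℕ.* (suc n C suc k) ℕ.+ suc (suc k) ℕ.* (suc n C suc (suc k))
    ≡⟨ cong₂ ℕ._+_ (absorption n k) (absorption n (suc k)) ⟩
  suc n ℕ.* (n C k) ℕ.+ suc n ℕ.* (n C suc k)   ≡⟨ sym (ℕP.*-distribˡ-+ (suc n) (n C k) (n C suc k)) ⟩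
  suc n ℕ.* (n C k ℕ.+ n C suc k)               ≡⟨ cong (suc n ℕ.*_) (sym (pascal n k)) ⟩
  suc n ℕ.* (suc n C suc k)                     ∎

⊛-binom-pascal : ∀ (a : Series) k n →
                 (a ⊛ binom (suc k)) (suc n) ≡ (a ⊛ binom (suc k)) n + (a ⊛ binom k) n
⊛-binom-pascal a k n = begin
  Σ≤ n (λ j → a j * binom (suc k) (suc n ∸ j)) + a (suc n) * binom (suc k) (n ∸ n)
    ≡⟨ cong₂ _+_ (Σ-cong-≤ n step) last ⟩
  Σ≤ n (λ j → a j * binom k (n ∸ j) + a j * binom (suc k) (n ∸ j)) + 0ℚ
    ≡⟨ trans (ℚP.+-identityʳ _) (Σ-+ n _ _) ⟩
  (a ⊛ binom k) n + (a ⊛ binom (suc k)) n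
    ≡⟨ ℚP.+-comm ((a ⊛ binom k) n) _ ⟩
  (a ⊛ binom (suc k)) n + (a ⊛ binom k) n ∎
  where
  step : ∀ j → j ≤ n → a j * binom (suc k) (suc n ∸ j) ≡ a j * binom k (n ∸ j) + a j * binom (suc k) (n ∸ j)
  step j j≤n = trans (cong (λ i → a j * binom (suc k) i) (suc-∸ n j j≤n))
                     (trans (cong (a j *_) (binom-pascal k (n ∸ j))) (ℚP.*-distribˡ-+ (a j) _ _))
  last : a (suc n) * binom (suc k) (n ∸ n) ≡ 0ℚ
  last = trans (cong (λ i → a (suc n) * binom (suc k) i) (ℕP.n∸n≡0 n)) (ℚP.*-zeroʳ (a (suc n)))

powerY : ℕ → Series
powerY k = xOver1mx ^ˢ k

y-⊛-zero : ∀ (g : Series) → (xOver1mx ⊛ g) 0 ≡ 0ℚ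
y-⊛-zero g = ℚP.*-zeroˡ (g 0)

y-⊛-suc : ∀ (g : Series) n → (xOver1mx ⊛ g) (suc n) ≡ ∂ g n
y-⊛-suc g n = begin
  (xOver1mx ⊛ g) (suc n)    ≡⟨ ⊛-comm xOver1mx g (suc n) ⟩
  Σ≤ n (λ j → g j * xOver1mx (suc n ∸ j)) + g (suc n) * xOver1mx (n ∸ n)
    ≡⟨ cong₂ _+_ (Σ-cong-≤ n (λ j j≤n → trans (cong (λ i → g j * xOver1mx i) (suc-∸ n j j≤n))
                                               (ℚP.*-identityʳ (g j))))
                 (trans (cong (λ i → g (suc n) * xOver1mx i) (ℕP.n∸n≡0 n)) (ℚP.*-zeroʳ (g (suc n)))) ⟩
  ∂ g n + 0ℚ                ≡⟨ ℚP.+-identityʳ (∂ g n) ⟩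
  ∂ g n                     ∎

∂-one : ∀ n → ∂ one n ≡ 1ℚ
∂-one zero    = refl
∂-one (suc n) = cong (_+ 0ℚ) (∂-one n)

partial-powerY : ∀ k n → ∂ (powerY k) n ≡ binom k n
partial-powerY zero    n       = trans (∂-one n) (sym (binom-zero n))
partial-powerY (suc k) zero    = y-⊛-zero (powerY k)
partial-powerY (suc k) (suc n) = begin
  ∂ (powerY (suc k)) n + (xOver1mx ⊛ powerY k) (suc n)
    ≡⟨ cong₂ _+_ (partial-powerY (suc k) n) (trans (y-⊛-suc (powerY k) n) (partial-powerY k n)) ⟩
  binom (suc k) n + binom k n     ≡⟨ ℚP.+-comm (binom (suc k) n) (binom k n) ⟩
  binom k n + binom (suc k) n     ≡⟨ sym (binom-pascal k n) ⟩
  binom (suc k) (suc n)           ∎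

∂-ln1mx : ∀ n → ∂ ln1mx n ≡ - H n
∂-ln1mx zero    = refl
∂-ln1mx (suc n) = trans (cong (_+ ln1mx (suc n)) (∂-ln1mx n)) (sym (ℚP.neg-distrib-+ (H n) (+ 1 / suc n)))

harmonicGap : ℕ → ℕ → ℚ
harmonicGap k n = binom k n * (H k - H n)

absorption-ℚ : ∀ n k → binom k n * (+ 1 / suc k) ≡ binom (suc k) (suc n) * (+ 1 / suc n)
absorption-ℚ n k = begin
  c * u                      ≡⟨ sym (ℚP.*-identityʳ (c * u)) ⟩
  c * u * 1ℚ                 ≡⟨ cong (c * u *_) (sym (ι-*-inverse n)) ⟩
  c * u * (ι (suc n) * v)    ≡⟨ solve 4 (λ c u b v → c :* u :* (b :* v) := u :* v :* (b :* c)) refl c u (ι (suc n)) v ⟩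
  u * v * (ι (suc n) * c)    ≡⟨ cong (u * v *_) (sym scaled) ⟩
  u * v * (ι (suc k) * c′)
    ≡⟨ solve 4 (λ c′ u v a → u :* v :* (a :* c′) := c′ :* v :* (a :* u)) refl c′ u v (ι (suc k)) ⟩
  c′ * v * (ι (suc k) * u)   ≡⟨ cong (c′ * v *_) (ι-*-inverse k) ⟩
  c′ * v * 1ℚ                ≡⟨ ℚP.*-identityʳ (c′ * v) ⟩
  c′ * v                     ∎
  where
  c = binom k n
  c′ = binom (suc k) (suc n)
  u = + 1 / suc k
  v = + 1 / suc n
  scaled : ι (suc k) * c′ ≡ ι (suc n) * c
  scaled = trans (sym (ι-* (suc k) (suc n C suc k))) (trans (cong ι (absorption n k)) (ι-* (suc n) (n C k)))

harmonicGap-pascal : ∀ k n → harmonicGap (suc k) n + harmonicGap k n ≡ harmonicGap (suc k) (suc n)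
harmonicGap-pascal k n = begin
  c1 * ((h + u) - g) + c0 * (h - g)
    ≡⟨ solve 5 (λ c0 c1 h u g → c1 :* ((h :+ u) :- g) :+ c0 :* (h :- g) := (c0 :+ c1) :* ((h :+ u) :- g) :- c0 :* u)
             refl c0 c1 h u g ⟩
  (c0 + c1) * ((h + u) - g) - c0 * u
    ≡⟨ cong (λ z → (c0 + c1) * ((h + u) - g) - z) (trans (absorption-ℚ n k) (cong (_* v) (binom-pascal k n))) ⟩
  (c0 + c1) * ((h + u) - g) - (c0 + c1) * v
    ≡⟨ solve 6 (λ c0 c1 h u g v → (c0 :+ c1) :* ((h :+ u) :- g) :- (c0 :+ c1) :* v := (c0 :+ c1) :* ((h :+ u) :- (g :+ v)))
             refl c0 c1 h u g v ⟩
  (c0 + c1) * ((h + u) - (g + v))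
    ≡⟨ cong (_* ((h + u) - (g + v))) (sym (binom-pascal k n)) ⟩
  harmonicGap (suc k) (suc n) ∎
  where
  c0 = binom k n
  c1 = binom (suc k) n
  h = H k
  g = H n
  u = + 1 / suc k
  v = + 1 / suc n

ln-⊛-binom : ∀ k n → (ln1mx ⊛ binom k) n ≡ harmonicGap k n
ln-⊛-binom zero n = begin
  Σ≤ n (λ j → ln1mx j * binom 0 (n ∸ j))
    ≡⟨ Σ-cong n (λ j → trans (cong (ln1mx j *_) (binom-zero (n ∸ j))) (ℚP.*-identityʳ (ln1mx j))) ⟩
  ∂ ln1mx n              ≡⟨ ∂-ln1mx n ⟩
  - H n                  ≡⟨ solve 1 (λ g → :- g := con 1ℚ :* (con 0ℚ :- g)) refl (H n) ⟩
  1ℚ * (0ℚ - H n)        ≡⟨ cong (_* (0ℚ - H n)) (sym (binom-zero n)) ⟩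
  harmonicGap 0 n        ∎
ln-⊛-binom (suc k) zero    = sym (ℚP.*-zeroˡ (H (suc k) - 0ℚ))
ln-⊛-binom (suc k) (suc n) = begin
  (ln1mx ⊛ binom (suc k)) (suc n)
    ≡⟨ ⊛-binom-pascal ln1mx k n ⟩
  (ln1mx ⊛ binom (suc k)) n + (ln1mx ⊛ binom k) n
    ≡⟨ cong₂ _+_ (ln-⊛-binom (suc k) n) (ln-⊛-binom k n) ⟩
  harmonicGap (suc k) n + harmonicGap k n
    ≡⟨ harmonicGap-pascal k n ⟩
  harmonicGap (suc k) (suc n) ∎

harmonicY : ℕ → Series
harmonicY k j = H k * powerY k j - (powerY k ⊛ ln1mx) j

partial-harmonicY : ∀ k n → ∂ (harmonicY k) n ≡ binom k n * H n
partial-harmonicY k n = begin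
  ∂ (harmonicY k) n                                            ≡⟨ Σ-- n _ _ ⟩
  Σ≤ n (λ j → H k * powerY k j) - ∂ (powerY k ⊛ ln1mx) n
    ≡⟨ cong₂ _-_ (trans (Σ-*ˡ n (H k) (powerY k)) (cong (H k *_) (partial-powerY k n))) log-part ⟩
  H k * c - c * (H k - H n)
    ≡⟨ solve 3 (λ h c g → h :* c :- c :* (h :- g) := c :* g) refl (H k) c (H n) ⟩
  c * H n                                                      ∎
  where
  c = binom k n
  log-part : ∂ (powerY k ⊛ ln1mx) n ≡ harmonicGap k n
  log-part = begin
    ∂ (powerY k ⊛ ln1mx) n     ≡⟨ Σ-cong n (⊛-comm (powerY k) ln1mx) ⟩
    ∂ (ln1mx ⊛ powerY k) n     ≡⟨ sym (⊛-∂ ln1mx (powerY k) n) ⟩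
    (ln1mx ⊛ ∂ (powerY k)) n   ≡⟨ Σ-cong n (λ j → cong (ln1mx j *_) (partial-powerY k (n ∸ j))) ⟩
    (ln1mx ⊛ binom k) n        ≡⟨ ln-⊛-binom k n ⟩
    harmonicGap k n            ∎

if-no : ∀ {P : Set} (d : Dec P) → ¬ P → {x y : ℕ} → (if ⌊ d ⌋ then x else y) ≡ y
if-no (yes p) ¬p = ⊥-elim (¬p p)
if-no (no _)  _  = refl

if-yes : ∀ {P : Set} (d : Dec P) → P → {x y : ℕ} → (if ⌊ d ⌋ then x else y) ≡ x
if-yes (yes _)  _ = refl
if-yes (no ¬p)  p = ⊥-elim (¬p p)

rS-above : ∀ r n k → n < k → rS r n k ≡ 0
rS-above r zero    (suc k) _         = refl
rS-above r (suc n) (suc k) (s≤s n<k) = by-cases (suc n <? r) (suc n ≟ r) (suc k ≟ r)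
  where
  by-cases : (d₁ : Dec (suc n < r)) (d₂ : Dec (suc n ≡ r)) (d₃ : Dec (suc k ≡ r)) →
             (if ⌊ d₁ ⌋ then 0 else if ⌊ d₂ ⌋ then (if ⌊ d₃ ⌋ then 1 else 0)
              else suc k ℕ.* rS r n (suc k) ℕ.+ rS r n k) ≡ 0
  by-cases (yes _) _        _        = refl
  by-cases (no _)  (yes e₂) (yes e₃) = ⊥-elim (ℕP.<-irrefl (trans e₂ (sym e₃)) (s≤s n<k))
  by-cases (no _)  (yes _)  (no _)   = refl
  by-cases (no _)  (no _)   _
    rewrite rS-above r n (suc k) (ℕP.m≤n⇒m≤1+n n<k) | rS-above r n k n<k =
    trans (ℕP.+-identityʳ (k ℕ.* 0)) (ℕP.*-zeroʳ k)

rS-rec : ∀ r m k → r ≤ m → rS r (suc m) (suc k) ≡ suc k ℕ.* rS r m (suc k) ℕ.+ rS r m k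
rS-rec r m k r≤m = trans (if-no (suc m <? r) (λ m<r → ℕP.≤⇒≯ r≤m (ℕP.<⇒≤ m<r)))
                         (if-no (suc m ≟ r) (λ m≡r → ℕP.1+n≰n (subst (_≤ m) (sym m≡r) r≤m)))

rS-diag-below : ∀ r k → k < r → rS r r k ≡ 0
rS-diag-below (suc r) zero    _   = refl
rS-diag-below (suc r) (suc k) k<r =
  trans (if-no (suc r <? suc r) (ℕP.<-irrefl refl))
        (trans (if-yes (suc r ≟ suc r) refl) (if-no (suc k ≟ suc r) (λ e → ℕP.<-irrefl e k<r)))

rS-diag : ∀ r → rS r r r ≡ 1
rS-diag zero    = refl
rS-diag (suc r) =
  trans (if-no (suc r <? suc r) (ℕP.<-irrefl refl))
        (trans (if-yes (suc r ≟ suc r) refl) (if-yes (suc r ≟ suc r) refl))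

rGeomCoef-rec : ∀ r m k → r ≤ m →
                rS r (suc m) (suc k) ℕ.* suc k ! ≡ suc k ℕ.* (rS r m (suc k) ℕ.* suc k ! ℕ.+ rS r m k ℕ.* k !)
rGeomCoef-rec r m k r≤m =
  trans (cong (ℕ._* suc k !) (rS-rec r m k r≤m)) (regroup k (rS r m (suc k)) (rS r m k) (k !))
  where
  regroup : ∀ k a b f → (suc k ℕ.* a ℕ.+ b) ℕ.* (suc k ℕ.* f) ≡ suc k ℕ.* (a ℕ.* (suc k ℕ.* f) ℕ.+ b ℕ.* f)
  regroup = solve-∀

rGeomBinom : ℕ → ℕ → ℕ → ℚ
rGeomBinom r m n = Σ≤ m (λ k → rFcoef r m k * binom k n)

Σ-top : ∀ n (f : ℕ → ℚ) → (∀ k → k < n → f k ≡ 0ℚ) → Σ≤ n f ≡ f n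
Σ-top zero    f _ = refl
Σ-top (suc n) f h =
  trans (cong (_+ f (suc n)) (Σ-zero n f (λ k k≤n → h k (s≤s k≤n)))) (ℚP.+-identityˡ (f (suc n)))

rGeomBinom-diag : ∀ r n → rGeomBinom r r n ≡ ι ((n C r) ℕ.* r ! ℕ.* n ℕ.^ 0)
rGeomBinom-diag r n = begin
  rGeomBinom r r n                 ≡⟨ Σ-top r _ below ⟩
  ι (rS r r r ℕ.* r !) * binom r n ≡⟨ cong (λ z → ι (z ℕ.* r !) * binom r n) (rS-diag r) ⟩
  ι (1 ℕ.* r !) * ι (n C r)        ≡⟨ sym (ι-* (1 ℕ.* r !) (n C r)) ⟩
  ι (1 ℕ.* r ! ℕ.* (n C r))        ≡⟨ cong ι (reorder (r !) (n C r)) ⟩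
  ι ((n C r) ℕ.* r ! ℕ.* 1)        ∎
  where
  below : ∀ k → k < r → rFcoef r r k * binom k n ≡ 0ℚ
  below k k<r = trans (cong (λ z → ι (z ℕ.* k !) * binom k n) (rS-diag-below r k k<r)) (ℚP.*-zeroˡ (binom k n))
  reorder : ∀ a b → 1 ℕ.* a ℕ.* b ≡ b ℕ.* a ℕ.* 1
  reorder = solve-∀

binomial-weight-ℚ : ∀ n k → ι k * binom k n + ι (suc k) * binom (suc k) n ≡ ι n * binom k n
binomial-weight-ℚ n k = begin
  ι k * binom k n + ι (suc k) * binom (suc k) n
    ≡⟨ sym (cong₂ _+_ (ι-* k (n C k)) (ι-* (suc k) (n C suc k))) ⟩
  ι (k ℕ.* (n C k)) + ι (suc k ℕ.* (n C suc k))
    ≡⟨ sym (ι-+ (k ℕ.* (n C k)) (suc k ℕ.* (n C suc k))) ⟩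
  ι (k ℕ.* (n C k) ℕ.+ suc k ℕ.* (n C suc k))  ≡⟨ cong ι (binomial-weight n k) ⟩
  ι (n ℕ.* (n C k))                            ≡⟨ ι-* n (n C k) ⟩
  ι n * binom k n                              ∎

-- Raising m by one multiplies the sum by n: the coefficient recurrence
-- splits each term in two, one half is re-indexed, and the weighted
-- Pascal rule recombines them.
rGeomBinom-step : ∀ r M n → r ≤ M → rGeomBinom r (suc M) n ≡ ι n * rGeomBinom r M n
rGeomBinom-step r M n r≤M = begin
  rGeomBinom r (suc M) n
    ≡⟨ Σ-front M (λ k → rFcoef r (suc M) k * binom k n) ⟩
  ι 0 * binom 0 n + Σ≤ M (λ k → rFcoef r (suc M) (suc k) * binom (suc k) n)
    ≡⟨ trans (cong (_+ Σ≤ M (λ k → rFcoef r (suc M) (suc k) * binom (suc k) n)) (ℚP.*-zeroˡ (binom 0 n)))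
             (ℚP.+-identityˡ _) ⟩
  Σ≤ M (λ k → rFcoef r (suc M) (suc k) * binom (suc k) n)
    ≡⟨ trans (Σ-cong M split) (Σ-+ M (λ k → weighted (suc k)) carried) ⟩
  Σ≤ M (λ k → weighted (suc k)) + Σ≤ M carried
    ≡⟨ cong (_+ Σ≤ M carried) (Σ-shift M weighted (ℚP.*-zeroˡ (g 0)) top-vanishes) ⟩
  Σ≤ M weighted + Σ≤ M carried
    ≡⟨ trans (sym (Σ-+ M weighted carried)) (Σ-cong M recombine) ⟩
  Σ≤ M (λ k → ι n * g k)
    ≡⟨ Σ-*ˡ M (ι n) g ⟩
  ι n * rGeomBinom r M n ∎
  where
  a : ℕ → ℚ
  a = rFcoef r M
  g weighted carried : ℕ → ℚ
  g k = a k * binom k n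
  weighted k = ι k * g k
  carried k = a k * (ι (suc k) * binom (suc k) n)
  split : ∀ k → rFcoef r (suc M) (suc k) * binom (suc k) n ≡ weighted (suc k) + carried k
  split k = begin
    rFcoef r (suc M) (suc k) * binom (suc k) n
      ≡⟨ cong (λ z → ι z * binom (suc k) n) (rGeomCoef-rec r M k r≤M) ⟩
    ι (suc k ℕ.* (A ℕ.+ B)) * binom (suc k) n
      ≡⟨ cong (_* binom (suc k) n) (trans (ι-* (suc k) (A ℕ.+ B)) (cong (ι (suc k) *_) (ι-+ A B))) ⟩
    ι (suc k) * (a (suc k) + a k) * binom (suc k) n
      ≡⟨ solve 4 (λ s A B c → s :* (A :+ B) :* c := s :* (A :* c) :+ B :* (s :* c)) refl
               (ι (suc k)) (a (suc k)) (a k) (binom (suc k) n) ⟩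
    weighted (suc k) + carried k ∎
    where
    A = rS r M (suc k) ℕ.* suc k !
    B = rS r M k ℕ.* k !
  top-vanishes : weighted (suc M) ≡ 0ℚ
  top-vanishes = trans (cong (λ z → ι (suc M) * (ι (z ℕ.* suc M !) * binom (suc M) n))
                             (rS-above r M (suc M) ℕP.≤-refl))
                       (trans (cong (ι (suc M) *_) (ℚP.*-zeroˡ (binom (suc M) n))) (ℚP.*-zeroʳ (ι (suc M))))
  recombine : ∀ k → weighted k + carried k ≡ ι n * g k
  recombine k = begin
    ι k * (a k * binom k n) + a k * (ι (suc k) * binom (suc k) n)
      ≡⟨ solve 5 (λ x A c y c′ → x :* (A :* c) :+ A :* (y :* c′) := A :* (x :* c :+ y :* c′)) refl
               (ι k) (a k) (binom k n) (ι (suc k)) (binom (suc k) n) ⟩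
    a k * (ι k * binom k n + ι (suc k) * binom (suc k) n)   ≡⟨ cong (a k *_) (binomial-weight-ℚ n k) ⟩
    a k * (ι n * binom k n)
      ≡⟨ solve 3 (λ A x c → A :* (x :* c) := x :* (A :* c)) refl (a k) (ι n) (binom k n) ⟩
    ι n * g k ∎

rGeomBinom-closed : ∀ r m n → r ≤ m → rGeomBinom r m n ≡ ι ((n C r) ℕ.* r ! ℕ.* n ℕ.^ (m ∸ r))
rGeomBinom-closed r m n r≤m =
  trans (cong (λ M → rGeomBinom r M n) (sym (ℕP.m∸n+n≡m r≤m))) (above-diagonal (m ∸ r))
  where
  above-diagonal : ∀ d → rGeomBinom r (d ℕ.+ r) n ≡ ι ((n C r) ℕ.* r ! ℕ.* n ℕ.^ d)
  above-diagonal zero    = rGeomBinom-diag r n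
  above-diagonal (suc d) = begin
    rGeomBinom r (suc d ℕ.+ r) n                    ≡⟨ rGeomBinom-step r (d ℕ.+ r) n (ℕP.m≤n+m r d) ⟩
    ι n * rGeomBinom r (d ℕ.+ r) n                  ≡⟨ cong (ι n *_) (above-diagonal d) ⟩
    ι n * ι ((n C r) ℕ.* r ! ℕ.* n ℕ.^ d)           ≡⟨ sym (ι-* n _) ⟩
    ι (n ℕ.* ((n C r) ℕ.* r ! ℕ.* n ℕ.^ d))         ≡⟨ cong ι (reorder n (n C r) (r !) (n ℕ.^ d)) ⟩
    ι ((n C r) ℕ.* r ! ℕ.* n ℕ.^ suc d)             ∎
    where
    reorder : ∀ n a b c → n ℕ.* (a ℕ.* b ℕ.* c) ≡ a ℕ.* b ℕ.* (n ℕ.* c)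
    reorder = solve-∀

bracket : ℕ → ℕ → Series
bracket m r = evalPoly m (rFhcoef r m) xOver1mx ⊖ (evalPoly m (rFcoef r m) xOver1mx ⊛ ln1mx)

bracket-expand : ∀ m r j → bracket m r j ≡ Σ≤ m (λ k → rFcoef r m k * harmonicY k j)
bracket-expand m r j = begin
  Σ≤ m (λ k → c k * H k * powerY k j) - (evalPoly m c xOver1mx ⊛ ln1mx) j
    ≡⟨ cong (λ z → Σ≤ m (λ k → c k * H k * powerY k j) - z) (evalPoly-⊛ m c xOver1mx ln1mx j) ⟩
  Σ≤ m (λ k → c k * H k * powerY k j) - Σ≤ m (λ k → c k * (powerY k ⊛ ln1mx) j)
    ≡⟨ sym (Σ-- m _ _) ⟩
  Σ≤ m (λ k → c k * H k * powerY k j - c k * (powerY k ⊛ ln1mx) j)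
    ≡⟨ Σ-cong m (λ k → solve 4 (λ a h y z → a :* h :* y :- a :* z := a :* (h :* y :- z)) refl
                               (c k) (H k) (powerY k j) ((powerY k ⊛ ln1mx) j)) ⟩
  Σ≤ m (λ k → c k * harmonicY k j) ∎
  where
  c = rFcoef r m

partial-bracket : ∀ m r → r ≤ m → ∀ n → ∂ (bracket m r) n ≡ term m r n
partial-bracket m r r≤m n = begin
  ∂ (bracket m r) n                                 ≡⟨ Σ-cong n (bracket-expand m r) ⟩
  Σ≤ n (λ j → Σ≤ m (λ k → c k * harmonicY k j))    ≡⟨ Σ-swap n m (λ j k → c k * harmonicY k j) ⟩
  Σ≤ m (λ k → Σ≤ n (λ j → c k * harmonicY k j))    ≡⟨ Σ-cong m (λ k → Σ-*ˡ n (c k) (harmonicY k)) ⟩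
  Σ≤ m (λ k → c k * ∂ (harmonicY k) n)              ≡⟨ Σ-cong m (λ k → cong (c k *_) (partial-harmonicY k n)) ⟩
  Σ≤ m (λ k → c k * (binom k n * H n))              ≡⟨ Σ-cong m (λ k → sym (ℚP.*-assoc (c k) (binom k n) (H n))) ⟩
  Σ≤ m (λ k → c k * binom k n * H n)                ≡⟨ Σ-*ʳ m (H n) (λ k → c k * binom k n) ⟩
  rGeomBinom r m n * H n                            ≡⟨ cong (_* H n) (rGeomBinom-closed r m n r≤m) ⟩
  term m r n                                        ∎
  where
  c = rFcoef r m

chainSum≡∂^ : ∀ s (f : Series) n → chainSum s f n ≡ ∂^ (suc s) f n
chainSum≡∂^ zero    f n = refl
chainSum≡∂^ (suc s) f n = Σ-cong n (chainSum≡∂^ s f)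

chainSum-zero : ∀ s (f : Series) → chainSum s f 0 ≡ f 0
chainSum-zero zero    f = refl
chainSum-zero (suc s) f = chainSum-zero s f

binomialWeighted : ℕ → Series → Series
binomialWeighted s f n = Σ≤ n (λ k → ι ((n ℕ.+ s ∸ k) C s) * f k)

-- Pascal's rule on the weights gives the recurrence of iterated partial sums.
binomialWeighted-pascal : ∀ s (f : Series) n →
  binomialWeighted (suc s) f (suc n) ≡ binomialWeighted (suc s) f n + binomialWeighted s f (suc n)
binomialWeighted-pascal s f n = begin
  Σ≤ n (λ k → ι ((suc n ℕ.+ suc s ∸ k) C suc s) * f k) + ι ((suc n ℕ.+ suc s ∸ suc n) C suc s) * f (suc n)
    ≡⟨ cong₂ _+_ (trans (Σ-cong-≤ n split) (Σ-+ n a b)) (cong (λ z → ι z * f (suc n)) (top (suc s))) ⟩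
  (Σ≤ n a + Σ≤ n b) + ι 1 * f (suc n)    ≡⟨ ℚP.+-assoc (Σ≤ n a) (Σ≤ n b) _ ⟩
  Σ≤ n a + (Σ≤ n b + ι 1 * f (suc n))    ≡⟨ cong (λ z → Σ≤ n a + (Σ≤ n b + ι z * f (suc n))) (sym (top s)) ⟩
  binomialWeighted (suc s) f n + binomialWeighted s f (suc n) ∎
  where
  a b : ℕ → ℚ
  a k = ι ((n ℕ.+ suc s ∸ k) C suc s) * f k
  b k = ι ((suc n ℕ.+ s ∸ k) C s) * f k
  top : ∀ t → (n ℕ.+ t ∸ n) C t ≡ 1
  top t = trans (cong (_C t) (ℕP.m+n∸m≡n n t)) (nCn≡1 t)
  split : ∀ k → k ≤ n → ι ((suc n ℕ.+ suc s ∸ k) C suc s) * f k ≡ a k + b k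
  split k k≤n = begin
    ι ((suc n ℕ.+ suc s ∸ k) C suc s) * f k          ≡⟨ cong (λ z → ι (z C suc s) * f k) e₁ ⟩
    binom (suc s) (suc x) * f k                       ≡⟨ cong (_* f k) (binom-pascal s x) ⟩
    (binom s x + binom (suc s) x) * f k               ≡⟨ ℚP.*-distribʳ-+ (f k) (binom s x) (binom (suc s) x) ⟩
    binom s x * f k + binom (suc s) x * f k           ≡⟨ ℚP.+-comm (binom s x * f k) _ ⟩
    binom (suc s) x * f k + binom s x * f k
      ≡⟨ cong₂ _+_ (cong (λ z → ι (z C suc s) * f k) (sym e₂)) (cong (λ z → ι (z C s) * f k) (sym e₃)) ⟩
    a k + b k                                          ∎
    where
    x = (n ∸ k) ℕ.+ suc s
    k≤1+n : k ≤ suc n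
    k≤1+n = ℕP.m≤n⇒m≤1+n k≤n
    e₁ : suc n ℕ.+ suc s ∸ k ≡ suc x
    e₁ = trans (ℕP.+-∸-comm (suc s) k≤1+n) (cong (ℕ._+ suc s) (suc-∸ n k k≤n))
    e₂ : n ℕ.+ suc s ∸ k ≡ x
    e₂ = ℕP.+-∸-comm (suc s) k≤n
    e₃ : suc n ℕ.+ s ∸ k ≡ x
    e₃ = trans (ℕP.+-∸-comm s k≤1+n) (trans (cong (ℕ._+ s) (suc-∸ n k k≤n)) (sym (ℕP.+-suc (n ∸ k) s)))

binomialWeighted≡chainSum : ∀ s (f : Series) n → binomialWeighted s f n ≡ chainSum s f n
binomialWeighted≡chainSum zero    f n       =
  Σ-cong n (λ k → trans (cong (_* f k) (binom-zero (n ℕ.+ 0 ∸ k))) (ℚP.*-identityˡ (f k)))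
binomialWeighted≡chainSum (suc s) f zero    =
  trans (cong (λ z → ι z * f 0) (nCn≡1 (suc s))) (trans (ℚP.*-identityˡ (f 0)) (sym (chainSum-zero s f)))
binomialWeighted≡chainSum (suc s) f (suc n) =
  trans (binomialWeighted-pascal s f n)
        (cong₂ _+_ (binomialWeighted≡chainSum (suc s) f n) (binomialWeighted≡chainSum s f (suc n)))

term-below : ∀ m r k → k < r → term m r k ≡ 0ℚ
term-below m r k k<r =
  trans (cong (λ z → ι (z ℕ.* r ! ℕ.* k ℕ.^ (m ∸ r)) * H k) (k>n⇒nCk≡0 k<r)) (ℚP.*-zeroˡ (H k))

fromIdx-vanishing : ∀ r (a : Series) n → (n < r → a n ≡ 0ℚ) → fromIdx r a n ≡ a n
fromIdx-vanishing r a n h with n <? r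
... | yes n<r = sym (h n<r)
... | no  _   = refl

mainTheorem12 : (m r s : ℕ) → r ≤ m →
    ((n : ℕ) → lhsSeries m r s n ≡ midSeries m r s n) ×
    ((n : ℕ) → midSeries m r s n ≡ rhsSeries m r s n)
mainTheorem12 m r s r≤m = first , second
  where
  first : (n : ℕ) → lhsSeries m r s n ≡ midSeries m r s n
  first n = cong (λ z → if ⌊ n <? r ⌋ then 0ℚ else z) (binomialWeighted≡chainSum s (term m r) n)
  chain≡rhs : ∀ n → chainSum s (term m r) n ≡ rhsSeries m r s n
  chain≡rhs n = begin
    chainSum s (term m r) n          ≡⟨ chainSum≡∂^ s (term m r) n ⟩
    ∂^ (suc s) (term m r) n          ≡⟨ ∂^-cong (suc s) _ _ (λ k → sym (partial-bracket m r r≤m k)) n ⟩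
    ∂^ (suc s) (∂ (bracket m r)) n   ≡⟨ ∂^-∂ (suc s) (bracket m r) n ⟩
    ∂^ (2 ℕ.+ s) (bracket m r) n     ≡⟨ cong (λ j → ∂^ j (bracket m r) n) (ℕP.+-comm 2 s) ⟩
    ∂^ (s ℕ.+ 2) (bracket m r) n     ≡⟨ sym (geom^-⊛ (s ℕ.+ 2) (bracket m r) n) ⟩
    rhsSeries m r s n                ∎
  second : (n : ℕ) → midSeries m r s n ≡ rhsSeries m r s n
  second n = trans (fromIdx-vanishing r (chainSum s (term m r)) n vanishes) (chain≡rhs n)
    where
    vanishes : n < r → chainSum s (term m r) n ≡ 0ℚ
    vanishes n<r = trans (chainSum≡∂^ s (term m r) n)
                         (∂^-vanish (suc s) (term m r) n (λ k k≤n → term-below m r k (ℕP.≤-<-trans k≤n n<r)))
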